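{- Let $R$ be a finite commutative chain ring, $E$ a finite set and $C\le R^E$ an $R$-code. Then the collection of circuits of $M(C)$ is $$\mathrm{Min}\bigl(\{\mathrm{supp}(\mathbf{x}) : \mathbf{x}\in\psi(C^\perp)\}\bigr),$$ the set of inclusion-minimal members of that family.
   Context: $R$ is local with maximal ideal $\mathfrak{m}$. Vectors $v_1,\dots,v_\ell$ are modular independent if $\sum\alpha_iv_i=0$ implies all $\alpha_i\in\mathfrak{m}$. For a generator matrix $G$ of $C$ (rows form a minimal generating set of $C$, columns indexed by $E$), $M(C)$ is the independence system on $E$ whose independent sets are the $I\subseteq E$ such that the columns of $G$ indexed by $I$ are modular independent (independent of the choice of $G$); circuits are minimal dependent sets. $C^\perp=\{\mathbf{x}\in R^E:\sum_i x_ic_i=0\ \forall\mathbf{c}\in C\}$. $\mathrm{supp}(\mathbf{x})=\{i\in E: x_i\neq0\}$. For an $R$-module $W$, $\psi(W)=\{\mathbf{w}\in W: \mathrm{Ann}_R(\mathbf{w})=\{0\}\}$, where $\mathrm{Ann}_R(\mathbf{w})=\{r\in R: r\mathbf{w}=0\}$. -}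

module Defs where

open import Level using (Level; _⊔_) renaming (suc to lsuc)
open import Algebra.Bundles using (CommutativeRing)
open import Data.Nat using (ℕ)
open import Data.Fin using (Fin; zero; suc)
open import Data.Fin.Subset using (Subset; _∈_; _∉_; _⊆_; _⊂_)
open import Data.Product using (Σ; ∃; _×_; _,_)
open import Data.Sum using (_⊎_)
open import Relation.Nullary using (¬_)
open import Relation.Unary using (Pred)
open import Function.Bundles using (_⇔_)

module _ {c ℓ : Level} (R : CommutativeRing c ℓ) where
  open CommutativeRing R hiding (zero)

  ∑ : {n : ℕ} → (Fin n → Carrier) → Carrier
  ∑ {ℕ.zero}  f = 0#
  ∑ {ℕ.suc n} f = f zero + ∑ (λ i → f (suc i))

  record IsIdeal (I : Pred Carrier (c ⊔ ℓ)) : Set (c ⊔ ℓ) where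
    field
      resp  : ∀ {x y} → x ≈ y → I x → I y
      zero∈ : I 0#
      +-closed : ∀ {x y} → I x → I y → I (x + y)
      *-closed : ∀ r {x} → I x → I (r * x)

  record IsFiniteChainRing : Set (lsuc (c ⊔ ℓ)) where
    field
      finite : Σ ℕ λ k → Σ (Fin k → Carrier) λ enum → ∀ x → ∃ λ i → enum i ≈ x
      nontrivial : ¬ (1# ≈ 0#)
      chain : ∀ I J → IsIdeal I → IsIdeal J →
              (∀ {x} → I x → J x) ⊎ (∀ {x} → J x → I x)

  -- the maximal ideal 𝔪 of the local ring R = the set of non-units
  𝔪 : Pred Carrier (c ⊔ ℓ)
  𝔪 x = ¬ (∃ λ y → x * y ≈ 1#)

  record IsCode {n : ℕ} {ℓ' : Level} (C : Pred (Fin n → Carrier) ℓ') : Set (c ⊔ ℓ ⊔ ℓ') where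
    field
      resp  : ∀ {x y} → (∀ i → x i ≈ y i) → C x → C y
      zero∈ : C (λ _ → 0#)
      +-closed : ∀ {x y} → C x → C y → C (λ i → x i + y i)
      *-closed : ∀ r {x} → C x → C (λ i → r * x i)

  Combo : {k n : ℕ} → (Fin k → Fin n → Carrier) → (Fin k → Carrier) → Fin n → Carrier
  Combo G a j = ∑ (λ i → a i * G i j)

  record IsGeneratorMatrix {k n : ℕ} {ℓ' : Level} (C : Pred (Fin n → Carrier) ℓ')
         (G : Fin k → Fin n → Carrier) : Set (c ⊔ ℓ ⊔ ℓ') where
    field
      rows∈ : ∀ i → C (G i)
      generates : ∀ x → C x → ∃ λ a → ∀ j → x j ≈ Combo G a j
      minimal : ∀ i → ¬ (∀ x → C x → ∃ λ a → a i ≈ 0# × (∀ j → x j ≈ Combo G a j))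

  -- the columns of G indexed by I are modular independent
  Independent : {k n : ℕ} → (Fin k → Fin n → Carrier) → Subset n → Set (c ⊔ ℓ)
  Independent G I =
    ∀ (α : _ → Carrier) → (∀ j → j ∉ I → α j ≈ 0#) →
    (∀ i → ∑ (λ j → α j * G i j) ≈ 0#) →
    ∀ j → j ∈ I → 𝔪 (α j)

  Dependent : {k n : ℕ} → (Fin k → Fin n → Carrier) → Subset n → Set (c ⊔ ℓ)
  Dependent G I = ¬ Independent G I

  Circuit : {k n : ℕ} → (Fin k → Fin n → Carrier) → Subset n → Set (c ⊔ ℓ)
  Circuit G I = Dependent G I × (∀ J → J ⊂ I → Independent G J)

  Dual : {n : ℕ} {ℓ' : Level} → Pred (Fin n → Carrier) ℓ' → Pred (Fin n → Carrier) (c ⊔ ℓ ⊔ ℓ')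
  Dual C x = ∀ y → C y → ∑ (λ i → x i * y i) ≈ 0#

  ψ : {n : ℕ} {ℓ' : Level} → Pred (Fin n → Carrier) ℓ' → Pred (Fin n → Carrier) (c ⊔ ℓ ⊔ ℓ')
  ψ W x = W x × (∀ r → (∀ i → r * x i ≈ 0#) → r ≈ 0#)

  IsSupp : {n : ℕ} → (Fin n → Carrier) → Subset n → Set ℓ
  IsSupp x I = ∀ i → (i ∈ I → ¬ (x i ≈ 0#)) × (¬ (x i ≈ 0#) → i ∈ I)

  SuppFamily : {n : ℕ} {ℓ' : Level} → Pred (Fin n → Carrier) ℓ' → Subset n → Set (c ⊔ ℓ ⊔ ℓ')
  SuppFamily C I = ∃ λ x → ψ (Dual C) x × IsSupp x I

  Min : {n : ℕ} {ℓ'' : Level} → (Subset n → Set ℓ'') → Subset n → Set ℓ''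
  Min F I = F I × (∀ J → F J → ¬ (J ⊂ I))

{-# OPTIONS --safe #-}
module Submission where

-- Over a finite chain ring R, a vector has trivial annihilator iff one of its
-- entries is a unit: the annihilators of the entries form a chain, so one of them
-- is the annihilator of the whole vector, and in a finite ring a non-zero-divisor
-- is a unit (two of its powers coincide). Hence, via the generator matrix G, the
-- elements of ψ(C⊥) are exactly the column relations of G with a unit coefficient,
-- i.e. the witnesses of modular dependence. So every support in the family is
-- dependent and every dependent set contains such a support; a family sandwiched
-- between another family and its upward closure has the same minimal members, and
-- the minimal dependent sets are the circuits.

open import Defs
open import Level using (Level; _⊔_; Lift; lift; lower) renaming (suc to lsuc)
open import Algebra.Bundles using (CommutativeRing)
open import Data.Nat using (ℕ; zero; suc)
import Data.Nat as ℕ using (_+_)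
import Data.Nat.Properties as ℕₚ
open import Data.Fin using (Fin; zero; suc; toℕ)
open import Data.Fin.Properties using (any?; all?; pigeonhole)
open import Data.Fin.Subset using (Subset; _∈_; _∉_; _⊆_)
open import Data.Fin.Subset.Properties using (_∈?_; ⊆-antisym; ⊆-⊂-trans)
open import Data.Bool.Properties using (T-≡)
open import Data.Product using (Σ; ∃; _×_; _,_; proj₁; proj₂)
open import Data.Empty using (⊥-elim)
open import Data.Sum using (_⊎_; inj₁; inj₂; reduce)
open import Data.Vec using (tabulate; lookup)
open import Data.Vec.Properties using (lookup∘tabulate; []=⇒lookup; lookup⇒[]=)
open import Data.Vec.Functional using (_∷_)
open import Function using (_∘_)
open import Function.Bundles using (_⇔_; mk⇔; Equivalence)
import Function.Properties.Equivalence as ⇔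
open import Relation.Binary.Bundles using (Setoid)
open import Relation.Binary.PropositionalEquality using (_≡_)
import Relation.Binary.PropositionalEquality as ≡
open import Relation.Nullary using (¬_; Dec; yes; no; does; Stable)
open import Relation.Nullary.Decidable
  using (map′; _×-dec_; _→-dec_; ¬?; toWitness; isYes≗does; dec-true; decidable-stable)
open import Relation.Unary using (Pred; Decidable)

IsFinite : ∀ {a ℓ} → Setoid a ℓ → Set (a ⊔ ℓ)
IsFinite S = Σ ℕ λ k → Σ (Fin k → Carrier) λ enum → ∀ x → ∃ λ i → enum i ≈ x
  where open Setoid S

module FiniteSetoid {a ℓ} (S : Setoid a ℓ) (finite : IsFinite S) where
  open Setoid S

  ∃? : ∀ {p} {P : Pred Carrier p} → (∀ {x y} → x ≈ y → P x → P y) →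
       Decidable P → Dec (∃ P)
  ∃? {P = P} resp P? = map′ (λ (i , p) → enum i , p) toIndex (any? (P? ∘ enum))
    where
    enum = proj₁ (proj₂ finite)
    toIndex : ∃ P → ∃ (P ∘ enum)
    toIndex (x , p) = let i , enumᵢ≈x = proj₂ (proj₂ finite) x in i , resp (sym enumᵢ≈x) p

  ∃-vector? : ∀ m {p} {Q : Pred (Fin m → Carrier) p} →
              (∀ {f g} → (∀ i → f i ≈ g i) → Q f → Q g) → Decidable Q → Dec (∃ Q)
  ∃-vector? zero    resp Q? = map′ (λ q → _ , q) (λ (_ , q) → resp (λ ()) q) (Q? (λ ()))
  ∃-vector? (suc m) {Q = Q} resp Q? =
    map′ (λ (x , f , q) → x ∷ f , q) uncons
         (∃? resp-head (λ x → ∃-vector? m (resp ∘ ∷-cong refl) (Q? ∘ (x ∷_))))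
    where
    ∷-cong : ∀ {x y} {f g : Fin m → Carrier} → x ≈ y → (∀ i → f i ≈ g i) →
             ∀ i → (x ∷ f) i ≈ (y ∷ g) i
    ∷-cong x≈y f≈g zero    = x≈y
    ∷-cong x≈y f≈g (suc i) = f≈g i
    resp-head : ∀ {x y} → x ≈ y → ∃ (Q ∘ (x ∷_)) → ∃ (Q ∘ (y ∷_))
    resp-head x≈y (f , q) = f , resp (∷-cong x≈y (λ _ → refl)) q
    uncons : ∃ Q → ∃ λ x → ∃ (Q ∘ (x ∷_))
    uncons (f , q) = f zero , f ∘ suc , resp (λ { zero → refl ; (suc i) → refl }) q

module _ {c ℓ : Level} (R : CommutativeRing c ℓ) where
  open CommutativeRing R hiding (zero)
  open import Algebra.Properties.Semiring.Sum semiring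
    using (sum; sum-cong-≋; sum-replicate-zero; ∑-comm; *-distribˡ-sum)
  open import Algebra.Properties.Semiring.Exp semiring using (_^_; ^-homo-*)
  open import Algebra.Properties.CommutativeSemigroup *-commutativeSemigroup
    using (x∙yz≈y∙xz)
  open import Algebra.Properties.Ring ring using ([y-z]x≈yx-zx)
  open import Algebra.Properties.AbelianGroup +-abelianGroup
    using (x∙y⁻¹≈ε⇒x≈y; x≈y⇒x∙y⁻¹≈ε)
  open import Relation.Binary.Reasoning.Setoid setoid

  -- ∑ R and the library's sum unfold alike but are not definitionally equal at a
  -- variable length.
  ∑≡sum : ∀ {m} (f : Fin m → Carrier) → ∑ R f ≡ sum f
  ∑≡sum {zero}  f = ≡.refl
  ∑≡sum {suc m} f = ≡.cong (f zero +_) (∑≡sum (f ∘ suc))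

  ∑-cong : ∀ {m} {f g : Fin m → Carrier} → (∀ i → f i ≈ g i) → ∑ R f ≈ ∑ R g
  ∑-cong {f = f} {g} f≈g = begin
    ∑ R f  ≡⟨ ∑≡sum f ⟩
    sum f  ≈⟨ sum-cong-≋ f≈g ⟩
    sum g  ≡⟨ ∑≡sum g ⟨
    ∑ R g  ∎

  IsUnit : Carrier → Set (c ⊔ ℓ)
  IsUnit x = ∃ λ y → x * y ≈ 1#

  IsNonZeroDivisor : Carrier → Set (c ⊔ ℓ)
  IsNonZeroDivisor x = ∀ r → r * x ≈ 0# → r ≈ 0#

  unit⇒nonZeroDivisor : ∀ {x} → IsUnit x → IsNonZeroDivisor x
  unit⇒nonZeroDivisor {x} (y , xy≈1) r rx≈0 = begin
    r            ≈⟨ *-identityʳ r ⟨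
    r * 1#       ≈⟨ *-congˡ xy≈1 ⟨
    r * (x * y)  ≈⟨ *-assoc r x y ⟨
    (r * x) * y  ≈⟨ *-congʳ rx≈0 ⟩
    0# * y       ≈⟨ zeroˡ y ⟩
    0#           ∎

  unit⇒≉0 : ¬ 1# ≈ 0# → ∀ {x} → IsUnit x → ¬ x ≈ 0#
  unit⇒≉0 1≉0 unit x≈0 =
    1≉0 (unit⇒nonZeroDivisor unit 1# (trans (*-identityˡ _) x≈0))

  nonZeroDivisor-cancelʳ : ∀ {x} → IsNonZeroDivisor x → ∀ r s → r * x ≈ s * x → r ≈ s
  nonZeroDivisor-cancelʳ {x} nzd r s rx≈sx =
    x∙y⁻¹≈ε⇒x≈y r s (nzd (r - s) (trans ([y-z]x≈yx-zx x r s) (x≈y⇒x∙y⁻¹≈ε rx≈sx)))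

  ^-nonZeroDivisor : ∀ {x} → IsNonZeroDivisor x → ∀ m → IsNonZeroDivisor (x ^ m)
  ^-nonZeroDivisor nzd zero    r r1≈0  = trans (sym (*-identityʳ r)) r1≈0
  ^-nonZeroDivisor {x} nzd (suc m) r rxxᵐ≈0 =
    nzd r (^-nonZeroDivisor nzd m (r * x) (trans (*-assoc r x (x ^ m)) rxxᵐ≈0))

  Principal : Carrier → Pred Carrier (c ⊔ ℓ)
  Principal x z = ∃ λ r → z ≈ r * x

  Annihilator : Carrier → Pred Carrier (c ⊔ ℓ)
  Annihilator x r = Lift c (r * x ≈ 0#)

  ZeroOrWhole : Carrier → Pred Carrier (c ⊔ ℓ)
  ZeroOrWhole x z = Lift c (z ≈ 0# ⊎ x ≈ 0#)

  principal-isIdeal : ∀ x → IsIdeal R (Principal x)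
  principal-isIdeal x = record
    { resp     = λ { z≈z′ (r , z≈rx) → r , trans (sym z≈z′) z≈rx }
    ; zero∈    = 0# , sym (zeroˡ x)
    ; +-closed = λ { (r , p) (s , q) → r + s , trans (+-cong p q) (sym (distribʳ x r s)) }
    ; *-closed = λ t → λ { (r , p) → t * r , trans (*-congˡ p) (sym (*-assoc t r x)) }
    }

  annihilator-isIdeal : ∀ x → IsIdeal R (Annihilator x)
  annihilator-isIdeal x = record
    { resp     = λ r≈r′ (lift rx≈0) → lift (trans (*-congʳ (sym r≈r′)) rx≈0)
    ; zero∈    = lift (zeroˡ x)
    ; +-closed = λ (lift p) (lift q) →
                   lift (trans (distribʳ x _ _) (trans (+-cong p q) (+-identityˡ 0#)))
    ; *-closed = λ t (lift p) → lift (trans (*-assoc t _ x) (trans (*-congˡ p) (zeroʳ t)))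
    }

  zeroOrWhole-isIdeal : ∀ x → IsIdeal R (ZeroOrWhole x)
  zeroOrWhole-isIdeal x = record
    { resp     = λ { z≈z′ (lift (inj₁ z≈0)) → lift (inj₁ (trans (sym z≈z′) z≈0))
                   ; _    (lift (inj₂ x≈0)) → lift (inj₂ x≈0) }
    ; zero∈    = lift (inj₁ refl)
    ; +-closed = λ { (lift (inj₁ p)) (lift (inj₁ q)) →
                       lift (inj₁ (trans (+-cong p q) (+-identityˡ 0#)))
                   ; (lift (inj₂ x≈0)) _ → lift (inj₂ x≈0)
                   ; _ (lift (inj₂ x≈0)) → lift (inj₂ x≈0) }
    ; *-closed = λ { t (lift (inj₁ z≈0)) → lift (inj₁ (trans (*-congˡ z≈0) (zeroʳ t)))
                   ; t (lift (inj₂ x≈0)) → lift (inj₂ x≈0) }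
    }

  IdealsFormChain : Set (lsuc (c ⊔ ℓ))
  IdealsFormChain = ∀ I J → IsIdeal R I → IsIdeal R J →
                    (∀ {x} → I x → J x) ⊎ (∀ {x} → J x → I x)

  Min-sandwich : ∀ {n ℓ₁ ℓ₂} {F : Subset n → Set ℓ₁} {D : Subset n → Set ℓ₂} →
                 (∀ {J} → F J → D J) → (∀ {J} → D J → ∃ λ J′ → J′ ⊆ J × F J′) →
                 ∀ I → Min R F I ⇔ Min R D I
  Min-sandwich {F = F} {D} F⇒D D⇒F⊆ I = mk⇔ to from
    where
    to : Min R F I → Min R D I
    to (FI , minF) = F⇒D FI , λ J DJ J⊂I →
      let J′ , J′⊆J , FJ′ = D⇒F⊆ DJ in minF J′ FJ′ (⊆-⊂-trans J′⊆J J⊂I)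
    from : Min R D I → Min R F I
    from (DI , minD) = ≡.subst F (⊆-antisym J′⊆I I⊆J′) FJ′ , λ J FJ → minD J (F⇒D FJ)
      where
      J′ = proj₁ (D⇒F⊆ DI)
      J′⊆I = proj₁ (proj₂ (D⇒F⊆ DI))
      FJ′ = proj₂ (proj₂ (D⇒F⊆ DI))
      I⊆J′ : I ⊆ J′
      I⊆J′ {x} x∈I = decidable-stable (x ∈? J′)
        λ x∉J′ → minD J′ (F⇒D FJ′) (J′⊆I , x , x∈I , x∉J′)

  module _ {k n : ℕ} (G : Fin k → Fin n → Carrier) where

    independent-stable : ∀ I → Stable (Independent R G I)
    independent-stable I ¬¬ind α outside≈0 relation j j∈I unit =
      ¬¬ind λ ind → ind α outside≈0 relation j j∈I unit

    circuit⇔Min-dependent : ∀ I → Circuit R G I ⇔ Min R (Dependent R G) I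
    circuit⇔Min-dependent I = mk⇔
      (λ (dep , minimal) → dep , λ J depJ J⊂I → depJ (minimal J J⊂I))
      (λ (dep , minimal) → dep , λ J J⊂I → independent-stable J (λ depJ → minimal J depJ J⊂I))

    ColumnRelation : (Fin n → Carrier) → Set ℓ
    ColumnRelation α = ∀ i → ∑ R (λ j → α j * G i j) ≈ 0#

    DependenceWitness : Subset n → (Fin n → Carrier) → Set (c ⊔ ℓ)
    DependenceWitness I α =
      (∀ j → j ∉ I → α j ≈ 0#) × ColumnRelation α × ∃ λ j → j ∈ I × IsUnit (α j)

    witness⇒dependent : ∀ {I α} → DependenceWitness I α → Dependent R G I
    witness⇒dependent {α = α} (outside≈0 , relation , j , j∈I , unit) ind =
      ind α outside≈0 relation j j∈I unit

    ¬witness⇒independent : ∀ {I} → ¬ ∃ (DependenceWitness I) → Independent R G I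
    ¬witness⇒independent ¬witness α outside≈0 relation j j∈I unit =
      ¬witness (α , outside≈0 , relation , j , j∈I , unit)

    module _ {ℓ′} {C : Pred (Fin n → Carrier) ℓ′} (gm : IsGeneratorMatrix R C G) where
      open IsGeneratorMatrix gm

      dual⇒columnRelation : ∀ {α} → Dual R C α → ColumnRelation α
      dual⇒columnRelation α∈C⊥ i = α∈C⊥ (G i) (rows∈ i)

      columnRelation⇒dual : ∀ {α} → ColumnRelation α → Dual R C α
      columnRelation⇒dual {α} relation y y∈C = begin
        ∑ R (λ j → α j * y j)                        ≡⟨ ∑≡sum (λ j → α j * y j) ⟩
        sum (λ j → α j * y j)                        ≈⟨ sum-cong-≋ (λ j → *-congˡ (y≈aG j)) ⟩
        sum (λ j → α j * sum (λ i → a i * G i j))    ≈⟨ sum-cong-≋ (λ j → *-distribˡ-sum (α j) (λ i → a i * G i j)) ⟩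
        sum (λ j → sum (λ i → α j * (a i * G i j)))  ≈⟨ sum-cong-≋ (λ j → sum-cong-≋ (λ i → x∙yz≈y∙xz (α j) (a i) (G i j))) ⟩
        sum (λ j → sum (λ i → a i * (α j * G i j)))  ≈⟨ ∑-comm (λ j i → a i * (α j * G i j)) ⟩
        sum (λ i → sum (λ j → a i * (α j * G i j)))  ≈⟨ sum-cong-≋ (λ i → *-distribˡ-sum (a i) (λ j → α j * G i j)) ⟨
        sum (λ i → a i * sum (λ j → α j * G i j))    ≈⟨ sum-cong-≋ (λ i → trans (*-congˡ (relation′ i)) (zeroʳ (a i))) ⟩
        sum {k} (λ _ → 0#)                           ≈⟨ sum-replicate-zero k ⟩
        0#                                           ∎
        where
        a = proj₁ (generates y y∈C)
        y≈aG : ∀ j → y j ≈ sum (λ i → a i * G i j)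
        y≈aG j = trans (proj₂ (generates y y∈C) j) (reflexive (∑≡sum (λ i → a i * G i j)))
        relation′ : ∀ i → sum (λ j → α j * G i j) ≈ 0#
        relation′ i = trans (reflexive (≡.sym (∑≡sum (λ j → α j * G i j)))) (relation i)

  module ChainRing (nontrivial : ¬ 1# ≈ 0#) (chain : IdealsFormChain) where

    -- ZeroOrWhole x is R if x ≈ 0 and (0) otherwise, so comparing it with Rx decides x ≈ 0.
    _≈0? : Decidable (_≈ 0#)
    x ≈0? with chain (ZeroOrWhole x) (Principal x) (zeroOrWhole-isIdeal x) (principal-isIdeal x)
    ... | inj₁ ZeroOrWhole⊆Rx = no λ x≈0 →
      let r , 1≈rx = ZeroOrWhole⊆Rx {1#} (lift (inj₂ x≈0))
      in nontrivial (trans 1≈rx (trans (*-congˡ x≈0) (zeroʳ r)))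
    ... | inj₂ Rx⊆ZeroOrWhole = yes (reduce (lower (Rx⊆ZeroOrWhole (1# , sym (*-identityˡ x)))))

    _≈?_ : ∀ x y → Dec (x ≈ y)
    x ≈? y = map′ (x∙y⁻¹≈ε⇒x≈y x y) x≈y⇒x∙y⁻¹≈ε ((x - y) ≈0?)

    least-ideal : ∀ {m} (I : Fin (suc m) → Pred Carrier (c ⊔ ℓ)) → (∀ i → IsIdeal R (I i)) →
                  ∃ λ j → ∀ i {x} → I j x → I i x
    least-ideal {zero}  I _ = zero , λ { zero p → p }
    least-ideal {suc m} I ideal with least-ideal (I ∘ suc) (ideal ∘ suc)
    ... | j , least with chain (I zero) (I (suc j)) (ideal zero) (ideal (suc j))
    ... | inj₁ I₀⊆Iⱼ = zero  , λ { zero p → p ; (suc i) p → least i (I₀⊆Iⱼ p) }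
    ... | inj₂ Iⱼ⊆I₀ = suc j , λ { zero p → Iⱼ⊆I₀ p ; (suc i) p → least i p }

    annihilator-attained : ∀ {m} (v : Fin (suc m) → Carrier) →
                           ∃ λ j → ∀ r → r * v j ≈ 0# → ∀ i → r * v i ≈ 0#
    annihilator-attained v =
      let j , least = least-ideal (Annihilator ∘ v) (annihilator-isIdeal ∘ v)
      in j , λ r rvⱼ≈0 i → lower (least i (lift rvⱼ≈0))

    supp : ∀ {n} → (Fin n → Carrier) → Subset n
    supp v = tabulate (λ i → does (¬? (v i ≈0?)))

    supp-isSupp : ∀ {n} (v : Fin n → Carrier) → IsSupp R v (supp v)
    supp-isSupp v i = ∈⇒≉0 , ≉0⇒∈
      where
      lookup-supp : lookup (supp v) i ≡ does (¬? (v i ≈0?))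
      lookup-supp = lookup∘tabulate _ i
      ∈⇒≉0 : i ∈ supp v → ¬ v i ≈ 0#
      ∈⇒≉0 i∈ = toWitness (Equivalence.from T-≡
        (≡.trans (isYes≗does (¬? (v i ≈0?))) (≡.trans (≡.sym lookup-supp) ([]=⇒lookup i∈))))
      ≉0⇒∈ : ¬ v i ≈ 0# → i ∈ supp v
      ≉0⇒∈ vᵢ≉0 = lookup⇒[]= i (supp v) (≡.trans lookup-supp (dec-true (¬? (v i ≈0?)) vᵢ≉0))

    isSupp⇒outside≈0 : ∀ {n} {v : Fin n → Carrier} {I} → IsSupp R v I → ∀ i → i ∉ I → v i ≈ 0#
    isSupp⇒outside≈0 {v = v} isSupp i i∉I =
      decidable-stable (v i ≈0?) (λ vᵢ≉0 → i∉I (proj₂ (isSupp i) vᵢ≉0))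

    outside≈0⇒supp⊆ : ∀ {n} {v : Fin n → Carrier} {I} → (∀ i → i ∉ I → v i ≈ 0#) → supp v ⊆ I
    outside≈0⇒supp⊆ {v = v} {I} outside≈0 {i} i∈supp =
      decidable-stable (i ∈? I) (λ i∉I → proj₁ (supp-isSupp v i) i∈supp (outside≈0 i i∉I))

  module FiniteRing (finite : IsFinite setoid) where
    private
      size = proj₁ finite
      enum = proj₁ (proj₂ finite)
      index : Carrier → Fin size
      index y = proj₁ (proj₂ (proj₂ finite) y)
      enum-index : ∀ y → enum (index y) ≈ y
      enum-index y = proj₂ (proj₂ (proj₂ finite) y)

    -- By pigeonhole xⁱ ≈ xⁱ⁺¹⁺ᵒ for some i and o; cancelling xⁱ leaves 1 ≈ x xᵒ.
    nonZeroDivisor⇒unit : ∀ {x} → IsNonZeroDivisor x → IsUnit x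
    nonZeroDivisor⇒unit {x} nzd
      with i , j , i<j , index-xⁱ≡index-xʲ ← pigeonhole (ℕₚ.n<1+n size) (λ m → index (x ^ toℕ m))
      with o , 1+i+o≡j ← ℕₚ.m≤n⇒∃[o]m+o≡n i<j
      = x ^ o , sym (nonZeroDivisor-cancelʳ (^-nonZeroDivisor nzd (toℕ i)) 1# (x * x ^ o) xⁱ≈xxᵒxⁱ)
      where
      xⁱ≈xxᵒxⁱ : 1# * x ^ toℕ i ≈ (x * x ^ o) * x ^ toℕ i
      xⁱ≈xxᵒxⁱ = begin
        1# * x ^ toℕ i               ≈⟨ *-identityˡ _ ⟩
        x ^ toℕ i                    ≈⟨ enum-index _ ⟨
        enum (index (x ^ toℕ i))     ≡⟨ ≡.cong enum index-xⁱ≡index-xʲ ⟩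
        enum (index (x ^ toℕ j))     ≈⟨ enum-index _ ⟩
        x ^ toℕ j                    ≡⟨ ≡.cong (x ^_) 1+i+o≡j ⟨
        x * x ^ (toℕ i ℕ.+ o)        ≈⟨ *-congˡ (^-homo-* x (toℕ i) o) ⟩
        x * (x ^ toℕ i * x ^ o)      ≈⟨ x∙yz≈y∙xz x _ _ ⟩
        x ^ toℕ i * (x * x ^ o)      ≈⟨ *-comm _ _ ⟩
        (x * x ^ o) * x ^ toℕ i      ∎

  module FiniteChainRing (isFiniteChainRing : IsFiniteChainRing R) where
    open IsFiniteChainRing isFiniteChainRing
    open ChainRing nontrivial chain
    open FiniteRing finite
    open FiniteSetoid setoid finite

    unit? : Decidable IsUnit
    unit? x = ∃? (λ y≈z xy≈1 → trans (*-congˡ (sym y≈z)) xy≈1) (λ y → (x * y) ≈? 1#)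

    trivialAnnihilator⇒unit-entry : ∀ {m} (v : Fin m → Carrier) →
                                    (∀ r → (∀ i → r * v i ≈ 0#) → r ≈ 0#) → ∃ λ j → IsUnit (v j)
    trivialAnnihilator⇒unit-entry {zero}  v trivial = ⊥-elim (nontrivial (trivial 1# (λ ())))
    trivialAnnihilator⇒unit-entry {suc m} v trivial =
      let j , attained = annihilator-attained v
      in j , nonZeroDivisor⇒unit (λ r rvⱼ≈0 → trivial r (attained r rvⱼ≈0))

    module _ {k n : ℕ} (G : Fin k → Fin n → Carrier) where

      dependenceWitness? : ∀ I α → Dec (DependenceWitness G I α)
      dependenceWitness? I α =
        all? (λ j → ¬? (j ∈? I) →-dec (α j ≈0?)) ×-dec
        all? (λ i → _ ≈0?) ×-dec
        any? (λ j → (j ∈? I) ×-dec unit? (α j))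

      dependenceWitness-resp : ∀ I {α β} → (∀ j → α j ≈ β j) →
                               DependenceWitness G I α → DependenceWitness G I β
      dependenceWitness-resp I α≈β (outside≈0 , relation , j , j∈I , y , αⱼy≈1) =
        (λ i i∉I → trans (sym (α≈β i)) (outside≈0 i i∉I)) ,
        (λ i → trans (∑-cong (λ j → *-congʳ (sym (α≈β j)))) (relation i)) ,
        j , j∈I , y , trans (*-congʳ (sym (α≈β j))) αⱼy≈1

      -- Dependence only says ¬ ¬ ∃ witness; the finite search produces one.
      dependent⇒witness : ∀ {I} → Dependent R G I → ∃ (DependenceWitness G I)
      dependent⇒witness {I} dep =
        decidable-stable (∃-vector? n (dependenceWitness-resp I) (dependenceWitness? I))
                         (dep ∘ ¬witness⇒independent G)

      module _ {ℓ′} {C : Pred (Fin n → Carrier) ℓ′} (gm : IsGeneratorMatrix R C G) where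

        suppFamily⇒dependent : ∀ {J} → SuppFamily R C J → Dependent R G J
        suppFamily⇒dependent (x , (x∈C⊥ , trivial) , isSupp) =
          let j , unit = trivialAnnihilator⇒unit-entry x trivial
          in witness⇒dependent G
               ( isSupp⇒outside≈0 isSupp
               , dual⇒columnRelation G gm x∈C⊥
               , j , proj₂ (isSupp j) (unit⇒≉0 nontrivial unit) , unit)

        dependent⇒suppFamily⊆ : ∀ {J} → Dependent R G J → ∃ λ J′ → J′ ⊆ J × SuppFamily R C J′
        dependent⇒suppFamily⊆ dep
          with α , outside≈0 , relation , j , _ , unit ← dependent⇒witness dep
          = supp α
          , outside≈0⇒supp⊆ outside≈0
          , α
          , (columnRelation⇒dual G gm relation , λ r rα≈0 → unit⇒nonZeroDivisor unit r (rα≈0 j))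
          , supp-isSupp α

proposition4p3 : ∀ {c ℓ ℓ' : Level} (R : CommutativeRing c ℓ) → IsFiniteChainRing R →
    (n : ℕ) (C : Pred (Fin n → CommutativeRing.Carrier R) ℓ') → IsCode R C →
    (k : ℕ) (G : Fin k → Fin n → CommutativeRing.Carrier R) → IsGeneratorMatrix R C G →
    (I : Subset n) → Circuit R G I ⇔ Min R (SuppFamily R C) I
proposition4p3 R isFiniteChainRing n C _ k G gm I =
  ⇔.trans (circuit⇔Min-dependent R G I)
          (⇔.sym (Min-sandwich R (suppFamily⇒dependent G gm) (dependent⇒suppFamily⊆ G gm) I))
  where open FiniteChainRing R isFiniteChainRing
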